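{- Let $m,n\ge2$ and let $k,l$ satisfy $F(m)\le k<F(m+1)$ and $F(n)\le l<F(n+1)$. Let $I=\{0,1,\dots,F(m)-1\}\cup\{F(m+2)-k-1,F(m+2)-k,\dots,F(m+1)-1\}$ and $J=\{0,1,\dots,F(n)-1\}\cup\{F(n+2)-l-1,F(n+2)-l,\dots,F(n+1)-1\}$. Then the $(k+1)(l+1)$ prefixes of size $(k,l)$ of the arrays $T_{\rm row}^{i}(T_{\rm col}^{j}(f_{m+1,n+1}))$, $i\in I$, $j\in J$, are the $(k+1)(l+1)$ distinct factors of $f_{\infty,\infty}$ of size $(k,l)$.
   Context: Fibonacci numbers: $F(0)=F(1)=1$, $F(n)=F(n-1)+F(n-2)$. $2D$ Fibonacci words $f_{m,n}$ over $\{a,b,c,d\}$: $f_{0,0}=a,f_{0,1}=b,f_{1,0}=c,f_{1,1}=d$, and for $k\ge0$, $m,n\ge1$: $f_{k,n+1}=f_{k,n}\obar f_{k,n-1}$ (column concatenation: side by side) and $f_{m+1,k}=f_{m,k}\ominus f_{m-1,k}$ (row concatenation: first on top of second); $f_{m,n}$ has $F(m)$ rows and $F(n)$ columns. For an array $w$ with rows $r_1,\dots,r_p$ and columns $c_1,\dots,c_q$: $T_{\rm col}(w)$ has columns $c_2,\dots,c_q,c_1$ and $T_{\rm row}(w)$ has rows $r_2,\dots,r_p,r_1$; powers are iterates, exponent $0$ the identity. The prefix of size $(k,l)$ of an array is its top-left block of $k$ rows and $l$ columns. $f_{\infty,\infty}=[f(i,j)]_{i,j\ge1}$ is the fixed point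 $\lim_{n}\mu^n(d)$ of the $2D$ morphism $d\mapsto\begin{smallmatrix}d&c\\ b&a\end{smallmatrix}$, $c\mapsto\begin{smallmatrix}d\\ b\end{smallmatrix}$, $b\mapsto\begin{smallmatrix}d&c\end{smallmatrix}$, $a\mapsto d$; equivalently, with $x=101101011\cdots$ the fixed point of $1\mapsto10,0\mapsto1$, $f(i,j)=d,c,b,a$ according as $(x_i,x_j)=(1,1),(1,0),(0,1),(0,0)$. A factor of size $(k,l)$ is a $k\times l$ block of $f_{\infty,\infty}$ in rows $i+1,\dots,i+k$, columns $j+1,\dots,j+l$ for some $i,j\ge0$. -}

module Defs where

open import Data.Nat using (ℕ; zero; suc; _+_; _∸_; _≤_; _<_)
open import Data.Bool using (Bool; true; false)
open import Data.List using (List; []; _∷_)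
open import Data.Vec using (Vec; []; _∷_; _∷ʳ_; _++_; zipWith; map; tabulate; [_])
open import Data.Fin using (toℕ)
open import Data.Sum using (_⊎_)
open import Data.Product using (_×_)

F : ℕ → ℕ
F zero = 1
F (suc zero) = 1
F (suc (suc n)) = F (suc n) + F n

data Letter : Set where
  a b c d : Letter

Array : ℕ → ℕ → Set
Array p q = Vec (Vec Letter q) p

_⦶_ : ∀ {p q r} → Array p q → Array p r → Array p (q + r)
u ⦶ v = zipWith _++_ u v

_⊖_ : ∀ {p r q} → Array p q → Array r q → Array (p + r) q
u ⊖ v = u ++ v

-- rows 0 and 1 of the 2D Fibonacci words, by the column recursion
f0 : (n : ℕ) → Array 1 (F n)
f0 zero = [ [ a ] ]
f0 (suc zero) = [ [ b ] ]
f0 (suc (suc n)) = f0 (suc n) ⦶ f0 n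

f1 : (n : ℕ) → Array 1 (F n)
f1 zero = [ [ c ] ]
f1 (suc zero) = [ [ d ] ]
f1 (suc (suc n)) = f1 (suc n) ⦶ f1 n

fw : (m n : ℕ) → Array (F m) (F n)
fw zero n = f0 n
fw (suc zero) n = f1 n
fw (suc (suc m)) n = fw (suc m) n ⊖ fw m n

rot : ∀ {A : Set} {q} → Vec A q → Vec A q
rot [] = []
rot (x ∷ xs) = xs ∷ʳ x

Tcol : ∀ {p q} → Array p q → Array p q
Tcol w = map rot w

Trow : ∀ {p q} → Array p q → Array p q
Trow w = rot w

iter : ∀ {A : Set} → ℕ → (A → A) → A → A
iter zero g x = x
iter (suc k) g x = g (iter k g x)

-- entry (r,c) (0-indexed) of a vector-of-rows array, default a out of range
entry : ∀ {p q} → Array p q → ℕ → ℕ → Letter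
entry [] r col = a
entry (row ∷ rows) (suc r) col = entry rows r col
entry (row ∷ rows) zero col = go row col
  where
  go : ∀ {q} → Vec Letter q → ℕ → Letter
  go [] _ = a
  go (x ∷ xs) zero = x
  go (x ∷ xs) (suc j) = go xs j

block : (ℕ → ℕ → Letter) → (i j k l : ℕ) → Array k l
block g i j k l = tabulate (λ r → tabulate (λ s → g (i + toℕ r) (j + toℕ s)))

prefix : ∀ {p q} → (k l : ℕ) → Array p q → Array k l
prefix k l w = block (entry w) 0 0 k l

-- infinite Fibonacci word x = 101101011..., fixed point of 1 ↦ 10, 0 ↦ 1
σ : List Bool → List Bool
σ [] = []
σ (true ∷ w) = true ∷ false ∷ σ w
σ (false ∷ w) = true ∷ σ w

sPow : ℕ → List Bool
sPow zero = true ∷ []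
sPow (suc n) = σ (sPow n)

nth : List Bool → ℕ → Bool
nth [] _ = false
nth (x ∷ xs) zero = x
nth (x ∷ xs) (suc i) = nth xs i

-- x i for i ≥ 1 (1-indexed); sPow i has length ≥ i + 1, so this is exact
x : ℕ → Bool
x i = nth (sPow i) (i ∸ 1)

letter : Bool → Bool → Letter
letter true true = d
letter true false = c
letter false true = b
letter false false = a

fInf : ℕ → ℕ → Letter
fInf i j = letter (x i) (x j)

factor : (i j k l : ℕ) → Array k l
factor i j k l = block fInf (suc i) (suc j) k l

InIdx : (m k i : ℕ) → Set
InIdx m k i = i < F m ⊎ (F (suc (suc m)) ∸ k ∸ 1 ≤ i × i < F (suc m))

shiftedPrefix : (m n k l i j : ℕ) → Array k l
shiftedPrefix m n k l i j = prefix k l (iter i Trow (iter j Tcol (fw (suc m) (suc n))))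

-- Row r of f_{m+1,n+1} is determined by the r-th letter of the Fibonacci word f_{m+1} (fib (suc m)),
-- its columns by the letters of f_{n+1}. Hence entry (r, s) of T_row^i (T_col^j f_{m+1,n+1}) is
-- letter (circ m (i + r)) (circ n (j + s)), where circ m reads f_{m+1} cyclically, while f∞,∞ has
-- entries letter (x p) (x q). The theorem is thus the product of two one-dimensional facts: for
-- F(m) ≤ k < F(m+1), the cyclic factors of f_{m+1} of length k starting in I are pairwise distinct,
-- each occurs in x, and every factor of x of length k is one of them.
--
-- All three rest on the near-commutativity of Fibonacci words: f_{m+1} f_m and f_m f_{m+1} differ
-- only in their last two letters. Distinctness goes by induction on k: when k grows by one, I gains
-- the start F(m+1) + t with t + k + 2 = F(m+2), whose window is the one at t except for its last
-- letter. The cyclic word f_{m+1} f_{m+1} sits at position F(m+2) in the prefix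
-- f_{m+4} = f_{m+2} f_{m+1} f_{m+1} f_m of x.
-- Conversely a factor of x lies in some f_{j+m+1} f_{m+2}, whose factors are cyclic factors of
-- f_{m+1} by induction on j, and a start F(m+1) + t outside I can be replaced by t.

{-# OPTIONS --safe #-}
module Submission where

open import Defs
open import Data.Nat
open import Data.Nat.Properties
open import Data.Nat.Tactic.RingSolver using (solve-∀)
open import Data.Bool using (Bool; true; false)
open import Data.List using (List; []; _∷_; _++_; length)
open import Data.List.Properties using (length-++; ++-assoc)
open import Data.Vec.Properties using (lookup∘tabulate; tabulate-cong)
open import Data.Fin using (toℕ; fromℕ<)
open import Data.Fin.Properties using (toℕ-fromℕ<; toℕ<n)
open import Data.Vec using (Vec; []; _∷_; _∷ʳ_; map; replicate; lookup) renaming (_++_ to _++ᵛ_)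
open import Data.Sum using (_⊎_; inj₁; inj₂)
open import Data.Product using (_×_; _,_; ∃-syntax; ∃₂)
open import Data.Empty using (⊥-elim)
open import Relation.Nullary using (¬_; yes; no)
open import Relation.Binary.PropositionalEquality
open ≡-Reasoning

-- Fibonacci numbers

F-pos : ∀ n → 0 < F n
F-pos zero = z<s
F-pos (suc zero) = z<s
F-pos (suc (suc n)) = <-≤-trans (F-pos (suc n)) (m≤m+n _ _)

suc-pred-F : ∀ n → suc (pred (F n)) ≡ F n
suc-pred-F n = suc-pred (F n) {{>-nonZero (F-pos n)}}

pred-F-suc-suc : ∀ n → pred (F (suc (suc n))) ≡ F (suc n) + pred (F n)
pred-F-suc-suc n = trans (cong (λ z → pred (F (suc n) + z)) (sym (suc-pred-F n)))
                         (cong pred (+-suc (F (suc n)) (pred (F n))))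

F-step : ∀ n → F n ≤ F (suc n)
F-step zero = ≤-refl
F-step (suc n) = m≤m+n _ _

F-mono : ∀ {m n} → m ≤ n → F m ≤ F n
F-mono m≤n = go (≤⇒≤′ m≤n)
  where
  go : ∀ {m n} → m ≤′ n → F m ≤ F n
  go ≤′-refl = ≤-refl
  go (≤′-step {n} p) = ≤-trans (go p) (F-step n)

n<F[1+n] : ∀ n → n < F (suc n)
n<F[1+n] zero = z<s
n<F[1+n] (suc n) = ≤-<-trans (n<F[1+n] n) (m<m+n _ (F-pos n))

2≤F[2+n] : ∀ n → 2 ≤ F (suc (suc n))
2≤F[2+n] n = +-mono-≤ (F-pos (suc n)) (F-pos n)

data Split (n : ℕ) : ℕ → Set where
  below : ∀ {j} → j < n → Split n j
  above : ∀ t → Split n (n + t)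

split : ∀ n j → Split n j
split zero j = above j
split (suc n) zero = below z<s
split (suc n) (suc j) with split n j
... | below j<n = below (s<s j<n)
... | above t = above t

-- Fibonacci words

fib : ℕ → List Bool
fib zero = false ∷ []
fib (suc zero) = true ∷ []
fib (suc (suc n)) = fib (suc n) ++ fib n

length-fib : ∀ n → length (fib n) ≡ F n
length-fib zero = refl
length-fib (suc zero) = refl
length-fib (suc (suc n)) =
  trans (length-++ (fib (suc n))) (cong₂ _+_ (length-fib (suc n)) (length-fib n))

length-fib-++ : ∀ m n → length (fib m ++ fib n) ≡ F m + F n
length-fib-++ m n = trans (length-++ (fib m)) (cong₂ _+_ (length-fib m) (length-fib n))

nth-++ˡ : ∀ (u v : List Bool) {j} → j < length u → nth (u ++ v) j ≡ nth u j
nth-++ˡ (_ ∷ u) v {zero} _ = refl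
nth-++ˡ (_ ∷ u) v {suc j} (s<s j<u) = nth-++ˡ u v j<u

nth-++ʳ : ∀ (u v : List Bool) t → nth (u ++ v) (length u + t) ≡ nth v t
nth-++ʳ [] v t = refl
nth-++ʳ (_ ∷ u) v t = nth-++ʳ u v t

nth-fib-++ˡ : ∀ n v {j} → j < F n → nth (fib n ++ v) j ≡ nth (fib n) j
nth-fib-++ˡ n v j<F = nth-++ˡ (fib n) v (subst (_ <_) (sym (length-fib n)) j<F)

nth-fib-++ʳ : ∀ n v t → nth (fib n ++ v) (F n + t) ≡ nth v t
nth-fib-++ʳ n v t = subst (λ z → nth (fib n ++ v) (z + t) ≡ nth v t) (length-fib n) (nth-++ʳ (fib n) v t)

nth-fib-++-cong : ∀ n {p q : List Bool} {l j} → (∀ t → t < l → nth p t ≡ nth q t) → j < F n + l →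
  nth (fib n ++ p) j ≡ nth (fib n ++ q) j
nth-fib-++-cong n {p} {q} {l} {j} p≈q j<F+l with split (F n) j
... | below j<F = trans (nth-fib-++ˡ n p j<F) (sym (nth-fib-++ˡ n q j<F))
... | above t = trans (nth-fib-++ʳ n p t)
  (trans (p≈q t (+-cancelˡ-< (F n) _ _ j<F+l)) (sym (nth-fib-++ʳ n q t)))

fib-prefix : ∀ {n n′ j} → n ≤ n′ → j < F (suc n) → nth (fib (suc n′)) j ≡ nth (fib (suc n)) j
fib-prefix {n} {n′} {j} n≤n′ j<F = go (≤⇒≤′ n≤n′)
  where
  go : ∀ {n″} → n ≤′ n″ → nth (fib (suc n″)) j ≡ nth (fib (suc n)) j
  go ≤′-refl = refl
  go (≤′-step {n″} p) =
    trans (nth-fib-++ˡ (suc n″) (fib n″) (<-≤-trans j<F (F-mono (s≤s (≤′⇒≤ p))))) (go p)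

fib-swap-agree : ∀ m {j} → j + 2 < F (suc (suc m)) →
  nth (fib (suc m) ++ fib m) j ≡ nth (fib m ++ fib (suc m)) j
fib-swap-agree zero {j} lt = ⊥-elim (≤⇒≯ (m≤n+m 2 j) lt)
fib-swap-agree (suc m) {j} lt
  rewrite ++-assoc (fib (suc m)) (fib m) (fib (suc m)) with split (F (suc m)) j
... | below j<F = trans (nth-fib-++ˡ (suc m) _ j<F) (sym (nth-fib-++ˡ (suc m) _ j<F))
... | above t = begin
  nth (fib (suc m) ++ (fib m ++ fib (suc m))) (F (suc m) + t) ≡⟨ nth-fib-++ʳ (suc m) _ t ⟩
  nth (fib m ++ fib (suc m)) t                                 ≡⟨ sym (fib-swap-agree m t+2<F) ⟩
  nth (fib (suc m) ++ fib m) t                                 ≡⟨ sym (nth-fib-++ʳ (suc m) _ t) ⟩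
  nth (fib (suc m) ++ (fib (suc m) ++ fib m)) (F (suc m) + t)  ∎
  where
  t+2<F : t + 2 < F (suc (suc m))
  t+2<F = +-cancelˡ-< (F (suc m)) _ _
    (subst₂ _<_ (+-assoc (F (suc m)) t 2) (+-comm (F (suc (suc m))) (F (suc m))) lt)

fib-swap-differ : ∀ m {j} → j + 2 ≡ F (suc (suc m)) →
  nth (fib (suc m) ++ fib m) j ≢ nth (fib m ++ fib (suc m)) j
fib-swap-differ zero {zero} _ ()
fib-swap-differ zero {suc j} e with +-cancelʳ-≡ 2 (suc j) 0 e
... | ()
fib-swap-differ (suc m) {j} e
  rewrite ++-assoc (fib (suc m)) (fib m) (fib (suc m)) with split (F (suc m)) j
... | below j<F = ⊥-elim (<⇒≢ j+2<F e)
  where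
  j+2<F : j + 2 < F (suc (suc (suc m)))
  j+2<F = subst (j + 2 <_) (+-comm (F (suc m)) (F (suc (suc m))))
    (+-mono-<-≤ j<F (2≤F[2+n] m))
... | above t = λ eq → fib-swap-differ m t+2≡F (begin
  nth (fib (suc m) ++ fib m) t                                 ≡⟨ sym (nth-fib-++ʳ (suc m) _ t) ⟩
  nth (fib (suc m) ++ (fib (suc m) ++ fib m)) (F (suc m) + t)  ≡⟨ sym eq ⟩
  nth (fib (suc m) ++ (fib m ++ fib (suc m))) (F (suc m) + t)  ≡⟨ nth-fib-++ʳ (suc m) _ t ⟩
  nth (fib m ++ fib (suc m)) t                                 ∎)
  where
  t+2≡F : t + 2 ≡ F (suc (suc m))
  t+2≡F = +-cancelˡ-≡ (F (suc m)) _ _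
    (trans (sym (+-assoc (F (suc m)) t 2)) (trans e (+-comm (F (suc (suc m))) (F (suc m)))))

lastBit : ℕ → Bool
lastBit n = nth (fib n) (pred (F n))

lastBit-suc-suc : ∀ n → lastBit (suc (suc n)) ≡ lastBit n
lastBit-suc-suc n =
  trans (cong (nth (fib (suc (suc n)))) (pred-F-suc-suc n)) (nth-fib-++ʳ (suc n) (fib n) (pred (F n)))

lastBit-suc : ∀ n → lastBit (suc n) ≢ lastBit n
lastBit-suc zero ()
lastBit-suc (suc n) e = lastBit-suc n (trans (sym e) (lastBit-suc-suc n))

σ-++ : ∀ u v → σ (u ++ v) ≡ σ u ++ σ v
σ-++ [] v = refl
σ-++ (true ∷ u) v = cong (λ z → true ∷ false ∷ z) (σ-++ u v)
σ-++ (false ∷ u) v = cong (true ∷_) (σ-++ u v)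

σ-fib : ∀ n → σ (fib n) ≡ fib (suc n)
σ-fib zero = refl
σ-fib (suc zero) = refl
σ-fib (suc (suc n)) = trans (σ-++ (fib (suc n)) (fib n)) (cong₂ _++_ (σ-fib (suc n)) (σ-fib n))

sPow≡fib : ∀ n → sPow n ≡ fib (suc n)
sPow≡fib zero = refl
sPow≡fib (suc n) = trans (cong σ (sPow≡fib n)) (σ-fib (suc n))

x≡nth-fib : ∀ n {j} → j < F (suc n) → x (suc j) ≡ nth (fib (suc n)) j
x≡nth-fib n {j} j<F with ≤-total n (suc j)
... | inj₁ n≤1+j = trans (cong (λ w → nth w j) (sPow≡fib (suc j))) (fib-prefix n≤1+j j<F)
... | inj₂ 1+j≤n = trans (cong (λ w → nth w j) (sPow≡fib (suc j)))
  (sym (fib-prefix 1+j≤n (<-≤-trans (n<F[1+n] j) (F-step (suc j)))))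

-- Cyclic Fibonacci words

-- circ m is the word f_{m+1} read cyclically; it is meant for positions below 2 F(m+1).
circ : ℕ → ℕ → Bool
circ m t = nth (fib (suc m) ++ fib (suc m)) t

circ-< : ∀ m {t} → t < F (suc m) → circ m t ≡ nth (fib (suc m)) t
circ-< m = nth-fib-++ˡ (suc m) (fib (suc m))

circ-+ : ∀ m t → circ m (F (suc m) + t) ≡ nth (fib (suc m)) t
circ-+ m = nth-fib-++ʳ (suc m) (fib (suc m))

circ-shift : ∀ m {t} → t < F m + F (suc m) →
  circ (suc m) (F (suc m) + t) ≡ nth (fib m ++ fib (suc m)) t
circ-shift m {t} t<F = begin
  nth ((fib (suc m) ++ fib m) ++ fib (suc (suc m))) (F (suc m) + t)
    ≡⟨ cong (λ w → nth w (F (suc m) + t)) (++-assoc (fib (suc m)) (fib m) (fib (suc (suc m)))) ⟩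
  nth (fib (suc m) ++ (fib m ++ fib (suc (suc m)))) (F (suc m) + t)
    ≡⟨ nth-fib-++ʳ (suc m) _ t ⟩
  nth (fib m ++ (fib (suc m) ++ fib m)) t
    ≡⟨ cong (λ w → nth w t) (sym (++-assoc (fib m) (fib (suc m)) (fib m))) ⟩
  nth ((fib m ++ fib (suc m)) ++ fib m) t
    ≡⟨ nth-++ˡ (fib m ++ fib (suc m)) (fib m) (subst (t <_) (sym (length-fib-++ m (suc m))) t<F) ⟩
  nth (fib m ++ fib (suc m)) t ∎

circ-shift-agree : ∀ m {t} → t + 2 < F (suc (suc m)) → circ (suc m) (F (suc m) + t) ≡ circ (suc m) t
circ-shift-agree m {t} lt = begin
  circ (suc m) (F (suc m) + t)  ≡⟨ circ-shift m (subst (t <_) (+-comm (F (suc m)) (F m)) t<F) ⟩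
  nth (fib m ++ fib (suc m)) t  ≡⟨ sym (fib-swap-agree m lt) ⟩
  nth (fib (suc (suc m))) t     ≡⟨ sym (circ-< (suc m) t<F) ⟩
  circ (suc m) t                ∎
  where
  t<F : t < F (suc (suc m))
  t<F = ≤-<-trans (m≤m+n t 2) lt

circ-shift-differ : ∀ m {t} → t + 2 ≡ F (suc (suc m)) → circ (suc m) (F (suc m) + t) ≢ circ (suc m) t
circ-shift-differ m {t} e eq = fib-swap-differ m e (begin
  nth (fib (suc (suc m))) t     ≡⟨ sym (circ-< (suc m) t<F) ⟩
  circ (suc m) t                ≡⟨ sym eq ⟩
  circ (suc m) (F (suc m) + t)  ≡⟨ circ-shift m (subst (t <_) (+-comm (F (suc m)) (F m)) t<F) ⟩
  nth (fib m ++ fib (suc m)) t  ∎)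
  where
  t<F : t < F (suc (suc m))
  t<F = subst (t <_) e (m<m+n t z<s)

circ-suc : ∀ n {t} → suc t < F (suc n) + F (suc n) → circ (suc n) t ≡ circ n t
circ-suc n {t} lt with split (F (suc n)) t
... | below t<A = trans (circ-< (suc n) (<-≤-trans t<A (F-step (suc n))))
  (trans (nth-fib-++ˡ (suc n) _ t<A) (sym (circ-< n t<A)))
... | above u = begin
  circ (suc n) (A + u)                ≡⟨ circ-shift n (<-≤-trans u<A (m≤n+m A (F n))) ⟩
  nth (fib n ++ fib (suc n)) u        ≡⟨ sym (fib-swap-agree n u+2<F) ⟩
  nth (fib (suc (suc n))) u           ≡⟨ nth-fib-++ˡ (suc n) _ u<A ⟩
  nth (fib (suc n)) u                 ≡⟨ sym (circ-+ n u) ⟩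
  circ n (A + u)                      ∎
  where
  A = F (suc n)
  u+1<A : u + 1 < A
  u+1<A = +-cancelˡ-< A _ _ (subst (_< A + A) (sym (trans (cong (A +_) (+-comm u 1)) (+-suc A u))) lt)
  u<A : u < A
  u<A = ≤-<-trans (m≤m+n u 1) u+1<A
  u+2<F : u + 2 < F (suc (suc n))
  u+2<F = subst (_< F (suc (suc n))) (+-assoc u 1 1) (+-mono-<-≤ u+1<A (F-pos n))

circ≡x : ∀ m {t} → t < F (suc m) + F (suc m) → circ m t ≡ x (suc (F (suc (suc m)) + t))
circ≡x m {t} t<2F = sym (begin
  x (suc (P + t))                                               ≡⟨ x≡nth-fib (suc (suc (suc m))) P+t<F ⟩
  nth ((fib (suc (suc m)) ++ fib (suc m)) ++ fib (suc (suc m))) (P + t)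
    ≡⟨ cong (λ w → nth w (P + t)) (++-assoc (fib (suc (suc m))) (fib (suc m)) (fib (suc (suc m)))) ⟩
  nth (fib (suc (suc m)) ++ (fib (suc m) ++ fib (suc (suc m)))) (P + t)
    ≡⟨ nth-fib-++ʳ (suc (suc m)) _ t ⟩
  nth (fib (suc m) ++ (fib (suc m) ++ fib m)) t
    ≡⟨ cong (λ w → nth w t) (sym (++-assoc (fib (suc m)) (fib (suc m)) (fib m))) ⟩
  nth ((fib (suc m) ++ fib (suc m)) ++ fib m) t
    ≡⟨ nth-++ˡ (fib (suc m) ++ fib (suc m)) (fib m)
               (subst (t <_) (sym (length-fib-++ (suc m) (suc m))) t<2F) ⟩
  circ m t                                                      ∎)
  where
  P = F (suc (suc m))
  P+t<F : P + t < F (suc (suc (suc (suc m))))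
  P+t<F = subst (P + t <_) (sym (+-assoc P (F (suc m)) P))
    (+-monoʳ-< P (<-≤-trans t<2F (+-monoʳ-≤ (F (suc m)) (F-step (suc m)))))

-- Distinct windows

Agree : ℕ → (ℕ → Bool) → ℕ → (ℕ → Bool) → ℕ → Set
Agree k u s v t = ∀ r → r < k → u (s + r) ≡ v (t + r)

-- The index set I, with F(m+2) ∸ k ∸ 1 ≤ i rewritten as F(m+2) ≤ k + (i + 1).
InIdx′ : ℕ → ℕ → ℕ → Set
InIdx′ m k i = i < F m ⊎ (F (suc (suc m)) ≤ k + suc i × i < F (suc m))

Distinct : ℕ → ℕ → Set
Distinct m k =
  ∀ {i i′} → InIdx′ m k i → InIdx′ m k i′ → Agree k (circ m) i (circ m) i′ → i ≡ i′

InIdx′-suc : ∀ m k {i} → InIdx′ m (suc k) i → InIdx′ m k i ⊎ F (suc (suc m)) ≡ suc k + suc i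
InIdx′-suc m k (inj₁ i<F) = inj₁ (inj₁ i<F)
InIdx′-suc m k (inj₂ (F≤ , i<F)) with m≤n⇒m<n∨m≡n F≤
... | inj₁ (s<s F≤′) = inj₁ (inj₂ (F≤′ , i<F))
... | inj₂ F≡ = inj₂ F≡

-- The start that I gains when k grows to k + 1 is F(m+1) + t, where t + k + 2 = F(m+2).
fresh-start-form : ∀ m {k j} → suc k < F (suc (suc m)) → F (suc (suc (suc m))) ≡ suc k + suc j →
  ∃[ t ] j ≡ F (suc m) + t × (t + k) + 2 ≡ F (suc (suc m))
fresh-start-form m {k} {j} k+1<N e with split (F (suc m)) j
... | below j<A = ⊥-elim (<-irrefl (sym e)
  (subst (_< N + A) (sym (ident k j)) (<-≤-trans (+-monoʳ-< (k + 2) j<A) (+-monoˡ-≤ A k+2≤N))))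
  where
  A = F (suc m)
  N = F (suc (suc m))
  k+2≤N : k + 2 ≤ N
  k+2≤N = subst (_≤ N) (+-comm 2 k) k+1<N
  ident : ∀ k j → suc k + suc j ≡ (k + 2) + j
  ident = solve-∀
... | above t = t , refl , +-cancelʳ-≡ (F (suc m)) _ _ (trans (ident k t (F (suc m))) (sym e))
  where
  ident : ∀ k t A → ((t + k) + 2) + A ≡ suc k + suc (A + t)
  ident = solve-∀

offset<F : ∀ m {k t} → F (suc m) ≤ k → (t + k) + 2 ≤ F (suc (suc m)) → t < F (suc m)
offset<F m {k} {t} A≤k le = <-≤-trans (m<m+n t z<s) (≤-trans t+2≤Fm (F-step m))
  where
  t+2≤Fm : t + 2 ≤ F m
  t+2≤Fm = +-cancelˡ-≤ (F (suc m)) _ _ (≤-trans (+-monoˡ-≤ (t + 2) A≤k)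
    (subst (_≤ F (suc (suc m))) (trans (cong (_+ 2) (+-comm t k)) (+-assoc k t 2)) le))

-- Its window repeats the window at t, which is already a start, except in the last letter.
fresh-start-unique : ∀ m {k j i′} → F (suc m) ≤ k → suc k < F (suc (suc m)) →
  F (suc (suc (suc m))) ≡ suc k + suc j → Distinct (suc m) k → InIdx′ (suc m) k i′ →
  ¬ Agree (suc k) (circ (suc m)) j (circ (suc m)) i′
fresh-start-unique m {k} {j} {i′} A≤k k+1<N e₀ IH Ii′ agree with fresh-start-form m k+1<N e₀
... | t , refl , e = circ-shift-differ m e (begin
  circ (suc m) (A + (t + k))  ≡⟨ cong (circ (suc m)) (sym (+-assoc A t k)) ⟩
  circ (suc m) (A + t + k)    ≡⟨ agree k (n<1+n k) ⟩
  circ (suc m) (i′ + k)       ≡⟨ cong (λ s → circ (suc m) (s + k)) (sym t≡i′) ⟩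
  circ (suc m) (t + k)        ∎)
  where
  A = F (suc m)
  t≡i′ : t ≡ i′
  t≡i′ = IH (inj₁ (offset<F m A≤k (≤-reflexive e))) Ii′ λ r r<k → begin
    circ (suc m) (t + r)        ≡⟨ sym (circ-shift-agree m
                                      (subst (t + r + 2 <_) e (+-monoˡ-< 2 (+-monoʳ-< t r<k)))) ⟩
    circ (suc m) (A + (t + r))  ≡⟨ cong (circ (suc m)) (sym (+-assoc A t r)) ⟩
    circ (suc m) (A + t + r)    ≡⟨ agree r (m<n⇒m<1+n r<k) ⟩
    circ (suc m) (i′ + r)       ∎

distinct-step : ∀ m {k} → F (suc m) ≤ k → suc k < F (suc (suc m)) →
  Distinct (suc m) k → Distinct (suc m) (suc k)
distinct-step m {k} A≤k k+1<N IH {i} {i′} Ii Ii′ agree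
  with InIdx′-suc (suc m) k Ii | InIdx′-suc (suc m) k Ii′
... | inj₁ Ii₀ | inj₁ Ii′₀ = IH Ii₀ Ii′₀ (λ r r<k → agree r (m<n⇒m<1+n r<k))
... | inj₂ e | inj₂ e′ = suc-injective (+-cancelˡ-≡ (suc k) _ _ (trans (sym e) e′))
... | inj₂ e | inj₁ Ii′₀ = ⊥-elim (fresh-start-unique m A≤k k+1<N e IH Ii′₀ agree)
... | inj₁ Ii₀ | inj₂ e′ =
  ⊥-elim (fresh-start-unique m A≤k k+1<N e′ IH Ii₀ (λ r r<k → sym (agree r r<k)))

InIdx′-top : ∀ n {i} → InIdx′ (suc n) (F (suc n)) i → i < F (suc n) ⊎ suc i ≡ F (suc (suc n))
InIdx′-top n (inj₁ i<A) = inj₁ i<A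
InIdx′-top n {i} (inj₂ (F≤ , i<N)) = inj₂ (≤-antisym i<N
  (+-cancelʳ-≤ (F (suc n)) _ (suc i) (subst (F (suc (suc (suc n))) ≤_) (+-comm (F (suc n)) (suc i)) F≤)))

InIdx′-below : ∀ n {i} → i < F (suc n) → InIdx′ n (pred (F (suc n))) i
InIdx′-below n {i} i<A with split (F n) i
... | below i<F = inj₁ i<F
... | above u = inj₂ (≤-trans (+-monoʳ-≤ A (m≤m+n (F n) u)) (≤-reflexive A+i≡) , i<A)
  where
  A = F (suc n)
  A+i≡ : A + (F n + u) ≡ pred A + suc (F n + u)
  A+i≡ = trans (cong (_+ (F n + u)) (sym (suc-pred-F (suc n)))) (sym (+-suc (pred A) (F n + u)))

-- The top start F(n+2) − 1 continues cyclically with the window at 0: against a start j with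
-- j + 1 < F(n+1) the previous level separates them, against j + 1 = F(n+1) the first letters differ.
top-low-disagree : ∀ n {i j} → Distinct n (pred (F (suc n))) → suc i ≡ F (suc (suc n)) → j < F (suc n) →
  ¬ Agree (F (suc n)) (circ (suc n)) i (circ (suc n)) j
top-low-disagree n {i} {j} IH e j<A agree with m≤n⇒m<n∨m≡n j<A
... | inj₁ j+1<A = 0≢1+n (IH (InIdx′-below n (F-pos (suc n))) (InIdx′-below n j+1<A) agree′)
  where
  A = F (suc n)
  agree′ : Agree (pred A) (circ n) 0 (circ n) (suc j)
  agree′ s s<A-1 = begin
    circ n s                       ≡⟨ circ-< n s<A ⟩
    nth (fib (suc n)) s            ≡⟨ sym (nth-fib-++ˡ (suc n) (fib n) s<A) ⟩
    nth (fib (suc (suc n))) s      ≡⟨ sym (circ-+ (suc n) s) ⟩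
    circ (suc n) (F (suc (suc n)) + s)  ≡⟨ cong (λ z → circ (suc n) (z + s)) (sym e) ⟩
    circ (suc n) (suc i + s)       ≡⟨ cong (circ (suc n)) (sym (+-suc i s)) ⟩
    circ (suc n) (i + suc s)       ≡⟨ agree (suc s) s+1<A ⟩
    circ (suc n) (j + suc s)       ≡⟨ circ-suc n (+-mono-< j+1<A s+1<A) ⟩
    circ n (j + suc s)             ≡⟨ cong (circ n) (+-suc j s) ⟩
    circ n (suc j + s)             ∎
    where
    s+1<A : suc s < A
    s+1<A = <-≤-trans (s<s s<A-1) (≤-reflexive (suc-pred-F (suc n)))
    s<A : s < A
    s<A = <-trans (n<1+n s) s+1<A
... | inj₂ j+1≡A = lastBit-suc (suc n) (begin
  lastBit (suc (suc n))          ≡⟨ cong (nth (fib (suc (suc n)))) (cong pred (sym e)) ⟩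
  nth (fib (suc (suc n))) i      ≡⟨ sym (circ-< (suc n) (subst (i <_) e (n<1+n i))) ⟩
  circ (suc n) i                 ≡⟨ cong (circ (suc n)) (sym (+-identityʳ i)) ⟩
  circ (suc n) (i + 0)           ≡⟨ agree 0 (F-pos (suc n)) ⟩
  circ (suc n) (j + 0)           ≡⟨ cong (circ (suc n)) (+-identityʳ j) ⟩
  circ (suc n) j                 ≡⟨ circ-< (suc n) (<-≤-trans j<A (F-step (suc n))) ⟩
  nth (fib (suc (suc n))) j      ≡⟨ nth-fib-++ˡ (suc n) (fib n) j<A ⟩
  nth (fib (suc n)) j            ≡⟨ cong (nth (fib (suc n))) (cong pred j+1≡A) ⟩
  lastBit (suc n)                ∎)

distinct-base : ∀ n → Distinct n (pred (F (suc n))) → Distinct (suc n) (F (suc n))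
distinct-base n IH Ii Ii′ agree with InIdx′-top n Ii | InIdx′-top n Ii′
... | inj₁ i<A | inj₁ i′<A = IH (InIdx′-below n i<A) (InIdx′-below n i′<A) λ r r<A-1 →
  let r+1<A = <-≤-trans (s<s r<A-1) (≤-reflexive (suc-pred-F (suc n)))
      in-range : ∀ {i} → i < F (suc n) → suc (i + r) < F (suc n) + F (suc n)
      in-range {i} i<A = subst (_< F (suc n) + F (suc n)) (+-suc i r) (+-mono-< i<A r+1<A)
  in trans (sym (circ-suc n (in-range i<A)))
       (trans (agree r (<-trans (n<1+n r) r+1<A)) (circ-suc n (in-range i′<A)))
... | inj₂ e | inj₂ e′ = suc-injective (trans e (sym e′))
... | inj₂ e | inj₁ i′<A = ⊥-elim (top-low-disagree n IH e i′<A agree)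
... | inj₁ i<A | inj₂ e′ = ⊥-elim (top-low-disagree n IH e′ i<A λ r r<A → sym (agree r r<A))

-- Induction on k through [F m, F (m + 1)); the base case k = F m uses the top of the range one level down.
distinct-top : ∀ n → Distinct n (pred (F (suc n)))
distinct-from : ∀ m δ → F m + δ < F (suc m) → Distinct m (F m + δ)

distinct-top zero Ii Ii′ _ = trans (only-start Ii) (sym (only-start Ii′))
  where
  only-start : ∀ {i} → InIdx′ 0 0 i → i ≡ 0
  only-start (inj₁ (s≤s z≤n)) = refl
  only-start (inj₂ (_ , s≤s z≤n)) = refl
distinct-top (suc n) = subst (Distinct (suc n)) (sym (pred-F-suc-suc n))
  (distinct-from (suc n) (pred (F n))
    (+-monoʳ-< (F (suc n)) (subst (pred (F n) <_) (suc-pred-F n) (n<1+n _))))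

distinct-from zero δ (s≤s ())
distinct-from (suc n) zero _ = subst (Distinct (suc n)) (sym (+-identityʳ _)) (distinct-base n (distinct-top n))
distinct-from (suc m) (suc δ) lt = subst (Distinct (suc m)) (sym (+-suc (F (suc m)) δ))
  (distinct-step m (m≤m+n (F (suc m)) δ) k+1<N (distinct-from (suc m) δ (<-trans (n<1+n _) k+1<N)))
  where
  k+1<N : suc (F (suc m) + δ) < F (suc (suc m))
  k+1<N = subst (_< F (suc (suc m))) (+-suc (F (suc m)) δ) lt

distinct : ∀ m {k} → F m ≤ k → k < F (suc m) → Distinct m k
distinct m Fm≤k k<F with m≤n⇒∃[o]m+o≡n Fm≤k
... | δ , refl = distinct-from m δ k<F

-- Covering the factors of x

-- A factor of x of length k lies in some f_{j+m+1}; the windows of f_{j+m+1} f_{m+2} are windows of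
-- circ (m + 1) by induction on j, starting from f_{m+1} f_{m+2} and f_{m+2} f_{m+2}.
module Covering (m : ℕ) {k : ℕ} (A≤k : F (suc m) ≤ k) (k<N : k < F (suc (suc m))) where

  private
    A N : ℕ
    A = F (suc m)
    N = F (suc (suc m))
    u v : List Bool
    u = fib (suc (suc m))
    v = fib (suc m)

  Covered : List Bool → Set
  Covered w = ∀ s → s + k ≤ length w → ∃[ i ] i < N × Agree k (nth w) s (circ (suc m)) i

  private
    start<N : ∀ {s} → s + k ≤ N → s < N
    start<N {s} s+k≤N = <-≤-trans (m<m+n s (<-≤-trans (F-pos (suc m)) A≤k)) s+k≤N

    window-bound : ∀ n {s l} → (F n + s) + k ≤ length (fib n ++ l) → s + k ≤ length l
    window-bound n {s} {l} le = +-cancelˡ-≤ (F n) _ _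
      (subst₂ _≤_ (+-assoc (F n) s k) (trans (length-++ (fib n)) (cong (_+ length l) (length-fib n))) le)

  window-after-fib : ∀ n {s} → s + k ≤ N → Agree k (nth (fib n ++ u)) (F n + s) (circ (suc m)) s
  window-after-fib n {s} s+k≤N r r<k = begin
    nth (fib n ++ u) (F n + s + r)   ≡⟨ cong (nth (fib n ++ u)) (+-assoc (F n) s r) ⟩
    nth (fib n ++ u) (F n + (s + r)) ≡⟨ nth-fib-++ʳ n u (s + r) ⟩
    nth u (s + r)                    ≡⟨ sym (circ-< (suc m) (<-≤-trans (+-monoʳ-< s r<k) s+k≤N)) ⟩
    circ (suc m) (s + r)             ∎

  covered-uu : Covered (u ++ u)
  covered-uu s s+k≤ with split N s
  ... | below s<N = s , s<N , λ _ _ → refl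
  ... | above s′ = s′ , start<N s′+k≤N , window-after-fib (suc (suc m)) s′+k≤N
    where
    s′+k≤N : s′ + k ≤ N
    s′+k≤N = subst (_ ≤_) (length-fib (suc (suc m))) (window-bound (suc (suc m)) s+k≤)

  covered-vu : Covered (v ++ u)
  covered-vu s s+k≤ with split A s
  ... | below s<A = s , <-≤-trans s<A (F-step (suc m)) , λ r r<k → begin
    nth (v ++ u) (s + r) ≡⟨ sym (fib-swap-agree (suc m) (s+r+2<F r<k)) ⟩
    nth (u ++ v) (s + r) ≡⟨ nth-fib-++-cong (suc (suc m)) v≈u (s+r<N+A r<k) ⟩
    circ (suc m) (s + r) ∎
    where
    v≈u : ∀ t → t < A → nth v t ≡ nth u t
    v≈u t t<A = sym (nth-fib-++ˡ (suc m) (fib m) t<A)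
    s+r<N+A : ∀ {r} → r < k → s + r < N + A
    s+r<N+A {r} r<k = subst (s + r <_) (+-comm A N) (+-mono-< s<A (<-trans r<k k<N))
    s+r+2<F : ∀ {r} → r < k → s + r + 2 < F (suc (suc (suc m)))
    s+r+2<F {r} r<k = subst₂ _≤_ (cong suc (trans (cong (s +_) (+-comm 2 r)) (sym (+-assoc s r 2))))
      (+-comm A N) (+-mono-≤ s<A (≤-<-trans r<k k<N))
  ... | above s′ = s′ , start<N s′+k≤N , window-after-fib (suc m) s′+k≤N
    where
    s′+k≤N : s′ + k ≤ N
    s′+k≤N = subst (_ ≤_) (length-fib (suc (suc m))) (window-bound (suc m) s+k≤)

  -- Only the first k letters of q matter for windows starting inside fib n.
  covered-++ : ∀ n {q} → Covered (fib n ++ u) → Covered q → (∀ t → t < k → nth q t ≡ nth u t) →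
    Covered (fib n ++ q)
  covered-++ n {q} cov-u cov-q q≈u s s+k≤ with split (F n) s
  ... | below s<F
    with cov-u s (subst (s + k ≤_) (sym (length-fib-++ n (suc (suc m)))) (<⇒≤ (+-mono-< s<F k<N)))
  ...   | i , i<N , agree = i , i<N , λ r r<k →
    trans (nth-fib-++-cong n q≈u (+-mono-< s<F r<k)) (agree r r<k)
  covered-++ n {q} cov-u cov-q q≈u s s+k≤ | above s′ with cov-q s′ (window-bound n s+k≤)
  ...   | i , i<N , agree = i , i<N , λ r r<k →
    trans (cong (nth (fib n ++ q)) (+-assoc (F n) s′ r)) (trans (nth-fib-++ʳ n q (s′ + r)) (agree r r<k))

  covered-fib : ∀ j → Covered (fib (suc (j + m)) ++ u)
  covered-fib zero = covered-vu
  covered-fib (suc zero) = covered-uu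
  covered-fib (suc (suc j)) = subst Covered (sym (++-assoc (fib (suc (suc (j + m)))) (fib (suc (j + m))) u))
    (covered-++ (suc (suc (j + m))) (covered-fib (suc j)) (covered-fib j) (starts-with-u j))
    where
    starts-with-u : ∀ j t → t < k → nth (fib (suc (j + m)) ++ u) t ≡ nth u t
    starts-with-u zero t t<k = trans (sym (fib-swap-agree (suc m) t+2<F)) (nth-fib-++ˡ (suc (suc m)) v t<N)
      where
      t<N : t < N
      t<N = <-trans t<k k<N
      t+2<F : t + 2 < F (suc (suc (suc m)))
      t+2<F = subst (_≤ N + A) (sym (cong suc (+-suc t 1))) (+-mono-≤ (≤-<-trans t<k k<N) (F-pos (suc m)))
    starts-with-u (suc j) t t<k =
      trans (nth-fib-++ˡ (suc (suc (j + m))) u (<-≤-trans t<N (F-mono (s≤s m+1≤))))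
            (fib-prefix m+1≤ t<N)
      where
      t<N : t < N
      t<N = <-trans t<k k<N
      m+1≤ : suc m ≤ suc (j + m)
      m+1≤ = s≤s (m≤n+m m j)

  x-window : ∀ p → ∃[ i ] i < N × Agree k (λ q → x (suc q)) p (circ (suc m)) i
  x-window p = from-fib (covered-fib (p + k) p p+k≤)
    where
    M = p + k + m
    p+k<F : p + k < F (suc M)
    p+k<F = ≤-<-trans (m≤m+n (p + k) m) (n<F[1+n] M)
    p+k≤ : p + k ≤ length (fib (suc M) ++ u)
    p+k≤ = subst (p + k ≤_) (sym (length-fib-++ (suc M) (suc (suc m))))
      (≤-trans (<⇒≤ p+k<F) (m≤m+n _ N))
    p+r<F : ∀ {r} → r < k → p + r < F (suc M)
    p+r<F r<k = <-trans (+-monoʳ-< p r<k) p+k<F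
    from-fib : ∃[ i ] i < N × Agree k (nth (fib (suc M) ++ u)) p (circ (suc m)) i →
               ∃[ i ] i < N × Agree k (λ q → x (suc q)) p (circ (suc m)) i
    from-fib (i , i<N , agree) = i , i<N , λ r r<k → begin
      x (suc (p + r))                  ≡⟨ x≡nth-fib M (p+r<F r<k) ⟩
      nth (fib (suc M)) (p + r)        ≡⟨ sym (nth-fib-++ˡ (suc M) u (p+r<F r<k)) ⟩
      nth (fib (suc M) ++ u) (p + r)   ≡⟨ agree r r<k ⟩
      circ (suc m) (i + r)             ∎

  x-window-start : ∀ p → ∃[ i ] InIdx′ (suc m) k i × Agree k (λ q → x (suc q)) p (circ (suc m)) i
  x-window-start p = into-I (x-window p)
    where
    into-I : ∃[ i ] i < N × Agree k (λ q → x (suc q)) p (circ (suc m)) i →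
             ∃[ i ] InIdx′ (suc m) k i × Agree k (λ q → x (suc q)) p (circ (suc m)) i
    into-I (i , i<N , agree) with split A i
    ... | below i<A = i , inj₁ i<A , agree
    ... | above t with F (suc (suc (suc m))) ≤? k + suc (A + t)
    ...   | yes F≤ = A + t , inj₂ (F≤ , i<N) , agree
    ...   | no F≰ = t , inj₁ (offset<F m A≤k t+k+2≤N) , λ r r<k → begin
      x (suc (p + r))            ≡⟨ agree r r<k ⟩
      circ (suc m) (A + t + r)   ≡⟨ cong (circ (suc m)) (+-assoc A t r) ⟩
      circ (suc m) (A + (t + r)) ≡⟨ circ-shift-agree m
                                      (<-≤-trans (+-monoˡ-< 2 (+-monoʳ-< t r<k)) t+k+2≤N) ⟩
      circ (suc m) (t + r)       ∎
      where
      ident : ∀ k A t → suc (k + suc (A + t)) ≡ A + ((t + k) + 2)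
      ident = solve-∀
      t+k+2≤N : (t + k) + 2 ≤ N
      t+k+2≤N = +-cancelˡ-≤ A _ _ (subst₂ _≤_ (ident k A t) (+-comm N A) (≰⇒> F≰))

-- Entries of the shifted arrays

lookupOr : ∀ {A : Set} {n} → A → Vec A n → ℕ → A
lookupOr δ [] _ = δ
lookupOr δ (y ∷ ys) zero = y
lookupOr δ (y ∷ ys) (suc j) = lookupOr δ ys j

lookupOr-replicate : ∀ {A : Set} n (δ : A) s → lookupOr δ (replicate n δ) s ≡ δ
lookupOr-replicate zero δ s = refl
lookupOr-replicate (suc n) δ zero = refl
lookupOr-replicate (suc n) δ (suc s) = lookupOr-replicate n δ s

entry≡lookupOr : ∀ {p q} (w : Array p q) r s → entry w r s ≡ lookupOr a (lookupOr (replicate q a) w r) s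
entry≡lookupOr {q = q} [] r s = sym (lookupOr-replicate q a s)
entry≡lookupOr (row ∷ rows) zero s = first-row row rows s
  where
  first-row : ∀ {p q} (row : Vec Letter q) (rows : Array p q) s →
    entry (row ∷ rows) zero s ≡ lookupOr a row s
  first-row [] rows s = refl
  first-row (y ∷ ys) rows zero = refl
  first-row (y ∷ ys) rows (suc s) = first-row ys [] s
entry≡lookupOr (row ∷ rows) (suc r) s = entry≡lookupOr rows r s

lookupOr-++ˡ : ∀ {A : Set} {n₁ n₂} (δ : A) (v₁ : Vec A n₁) (v₂ : Vec A n₂) {r} → r < n₁ →
  lookupOr δ (v₁ ++ᵛ v₂) r ≡ lookupOr δ v₁ r
lookupOr-++ˡ δ (y ∷ v₁) v₂ {zero} _ = refl
lookupOr-++ˡ δ (y ∷ v₁) v₂ {suc r} (s<s r<n) = lookupOr-++ˡ δ v₁ v₂ r<n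

lookupOr-++ʳ : ∀ {A : Set} {n₁ n₂} (δ : A) (v₁ : Vec A n₁) (v₂ : Vec A n₂) t →
  lookupOr δ (v₁ ++ᵛ v₂) (n₁ + t) ≡ lookupOr δ v₂ t
lookupOr-++ʳ δ [] v₂ t = refl
lookupOr-++ʳ δ (y ∷ v₁) v₂ t = lookupOr-++ʳ δ v₁ v₂ t

lookupOr-map : ∀ {A B : Set} {n} (δ : A) (δ′ : B) (f : A → B) (v : Vec A n) {r} → r < n →
  lookupOr δ′ (map f v) r ≡ f (lookupOr δ v r)
lookupOr-map δ δ′ f (y ∷ v) {zero} _ = refl
lookupOr-map δ δ′ f (y ∷ v) {suc r} (s<s r<n) = lookupOr-map δ δ′ f v r<n

lookupOr-rot : ∀ {A : Set} {n} (δ : A) (v : Vec A n) {r} → r < n →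
  lookupOr δ (rot v) r ≡ lookupOr δ (v ++ᵛ v) (suc r)
lookupOr-rot δ (y ∷ v) {r} (s<s r<n) with m≤n⇒m<n∨m≡n r<n
... | inj₁ r<n′ = trans (snoc-< v r<n′) (sym (lookupOr-++ˡ δ v (y ∷ v) r<n′))
  where
  snoc-< : ∀ {n} (v : Vec _ n) {r} → r < n → lookupOr δ (v ∷ʳ y) r ≡ lookupOr δ v r
  snoc-< (z ∷ v) {zero} _ = refl
  snoc-< (z ∷ v) {suc r} (s<s r<n) = snoc-< v r<n
... | inj₂ refl = trans (snoc-last v) (sym (trans (cong (lookupOr δ (v ++ᵛ y ∷ v)) (sym (+-identityʳ r)))
  (lookupOr-++ʳ δ v (y ∷ v) 0)))
  where
  snoc-last : ∀ {n} (v : Vec _ n) → lookupOr δ (v ∷ʳ y) n ≡ y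
  snoc-last [] = refl
  snoc-last (z ∷ v) = snoc-last v

lookupOr-++-period : ∀ {A : Set} {n} (δ : A) (v : Vec A n) {i} → i < n →
  lookupOr δ (v ++ᵛ v) (n + i) ≡ lookupOr δ (v ++ᵛ v) i
lookupOr-++-period δ v i<n = trans (lookupOr-++ʳ δ v v _) (sym (lookupOr-++ˡ δ v v i<n))

lookupOr-iter-rot : ∀ {A : Set} {n} (δ : A) (v : Vec A n) {i r} → i < n → r < n →
  lookupOr δ (iter i rot v) r ≡ lookupOr δ (v ++ᵛ v) (i + r)
lookupOr-iter-rot δ v {zero} _ r<n = sym (lookupOr-++ˡ δ v v r<n)
lookupOr-iter-rot {n = n} δ v {suc i} {r} i+1<n r<n
  rewrite lookupOr-rot δ (iter i rot v) r<n with m≤n⇒m<n∨m≡n r<n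
... | inj₁ r+1<n = trans (lookupOr-++ˡ δ w w r+1<n)
  (trans (lookupOr-iter-rot δ v i<n r+1<n) (cong (lookupOr δ (v ++ᵛ v)) (+-suc i r)))
  where
  w = iter i rot v
  i<n = <-trans (n<1+n i) i+1<n
... | inj₂ refl = begin
  lookupOr δ (w ++ᵛ w) (suc r)       ≡⟨ cong (lookupOr δ (w ++ᵛ w)) (sym (+-identityʳ (suc r))) ⟩
  lookupOr δ (w ++ᵛ w) (suc r + 0)   ≡⟨ lookupOr-++ʳ δ w w 0 ⟩
  lookupOr δ w 0                     ≡⟨ lookupOr-iter-rot δ v i<n z<s ⟩
  lookupOr δ (v ++ᵛ v) (i + 0)       ≡⟨ cong (lookupOr δ (v ++ᵛ v)) (+-identityʳ i) ⟩
  lookupOr δ (v ++ᵛ v) i             ≡⟨ sym (lookupOr-++-period δ v i<n) ⟩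
  lookupOr δ (v ++ᵛ v) (suc r + i)   ≡⟨ cong (lookupOr δ (v ++ᵛ v)) (trans (+-comm (suc r) i) (+-suc i r)) ⟩
  lookupOr δ (v ++ᵛ v) (suc i + r)   ∎
  where
  w = iter i rot v
  i<n = <-trans (n<1+n i) i+1<n

lookupOr-iter-Tcol : ∀ {p q} (w : Array p q) j {r} → r < p →
  lookupOr (replicate q a) (iter j Tcol w) r ≡ iter j rot (lookupOr (replicate q a) w r)
lookupOr-iter-Tcol w zero r<p = refl
lookupOr-iter-Tcol {q = q} w (suc j) r<p =
  trans (lookupOr-map (replicate q a) (replicate q a) rot (iter j Tcol w) r<p)
        (cong rot (lookupOr-iter-Tcol w j r<p))

lookupOr-fib : ∀ {A : Set} (δ : A) (f : Bool → A) (V : (n : ℕ) → Vec A (F n)) →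
  lookupOr δ (V 0) 0 ≡ f false → lookupOr δ (V 1) 0 ≡ f true →
  (∀ n → V (suc (suc n)) ≡ V (suc n) ++ᵛ V n) →
  ∀ n {s} → s < F n → lookupOr δ (V n) s ≡ f (nth (fib n) s)
lookupOr-fib δ f V V₀ V₁ V-step zero {zero} _ = V₀
lookupOr-fib δ f V V₀ V₁ V-step zero {suc s} (s<s ())
lookupOr-fib δ f V V₀ V₁ V-step (suc zero) {zero} _ = V₁
lookupOr-fib δ f V V₀ V₁ V-step (suc zero) {suc s} (s<s ())
lookupOr-fib δ f V V₀ V₁ V-step (suc (suc n)) {s} s<F =
  trans (cong (λ w → lookupOr δ w s) (V-step n))
        (halves (split (F (suc n)) s) s<F (lookupOr-fib δ f V V₀ V₁ V-step (suc n))
                (lookupOr-fib δ f V V₀ V₁ V-step n))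
  where
  halves : ∀ {s} → Split (F (suc n)) s → s < F (suc (suc n)) →
    (∀ {s} → s < F (suc n) → lookupOr δ (V (suc n)) s ≡ f (nth (fib (suc n)) s)) →
    (∀ {s} → s < F n → lookupOr δ (V n) s ≡ f (nth (fib n) s)) →
    lookupOr δ (V (suc n) ++ᵛ V n) s ≡ f (nth (fib (suc (suc n))) s)
  halves (below s<F′) _ IH₁ IH₀ = trans (lookupOr-++ˡ δ (V (suc n)) (V n) s<F′)
    (trans (IH₁ s<F′) (cong f (sym (nth-fib-++ˡ (suc n) (fib n) s<F′))))
  halves (above t) s<F IH₁ IH₀ = trans (lookupOr-++ʳ δ (V (suc n)) (V n) t)
    (trans (IH₀ (+-cancelˡ-< (F (suc n)) _ _ s<F)) (cong f (sym (nth-fib-++ʳ (suc n) (fib n) t))))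

lookupOr-twice : ∀ {A : Set} {n} (δ : A) (f : Bool → A) (v : Vec A n) (w : List Bool) → length w ≡ n →
  (∀ {s} → s < n → lookupOr δ v s ≡ f (nth w s)) →
  ∀ {t} → t < n + n → lookupOr δ (v ++ᵛ v) t ≡ f (nth (w ++ w) t)
lookupOr-twice {n = n} δ f v w |w|≡n v≈w {t} t<2n with split n t
... | below t<n = trans (lookupOr-++ˡ δ v v t<n)
  (trans (v≈w t<n) (cong f (sym (nth-++ˡ w w (subst (t <_) (sym |w|≡n) t<n)))))
... | above u = trans (lookupOr-++ʳ δ v v u) (trans (v≈w (+-cancelˡ-< n _ _ t<2n))
  (cong f (sym (subst (λ l → nth (w ++ w) (l + u) ≡ nth w u) |w|≡n (nth-++ʳ w w u)))))

fibRow : Bool → (n : ℕ) → Vec Letter (F n)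
fibRow β zero = letter β false ∷ []
fibRow β (suc zero) = letter β true ∷ []
fibRow β (suc (suc n)) = fibRow β (suc n) ++ᵛ fibRow β n

f0≡fibRow : ∀ n → f0 n ≡ fibRow false n ∷ []
f0≡fibRow zero = refl
f0≡fibRow (suc zero) = refl
f0≡fibRow (suc (suc n)) rewrite f0≡fibRow (suc n) | f0≡fibRow n = refl

f1≡fibRow : ∀ n → f1 n ≡ fibRow true n ∷ []
f1≡fibRow zero = refl
f1≡fibRow (suc zero) = refl
f1≡fibRow (suc (suc n)) rewrite f1≡fibRow (suc n) | f1≡fibRow n = refl

lookupOr-fibRow : ∀ β n {s} → s < F n → lookupOr a (fibRow β n) s ≡ letter β (nth (fib n) s)
lookupOr-fibRow β = lookupOr-fib a (letter β) (fibRow β) refl refl (λ _ → refl)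

lookupOr-fw : ∀ m n {r} → r < F m → lookupOr (replicate (F n) a) (fw m n) r ≡ fibRow (nth (fib m) r) n
lookupOr-fw m n = lookupOr-fib (replicate (F n) a) (λ β → fibRow β n) (λ m → fw m n)
  (cong (λ w → lookupOr (replicate (F n) a) w 0) (f0≡fibRow n))
  (cong (λ w → lookupOr (replicate (F n) a) w 0) (f1≡fibRow n)) (λ _ → refl) m

shifted : (m n i j : ℕ) → Array (F (suc m)) (F (suc n))
shifted m n i j = iter i Trow (iter j Tcol (fw (suc m) (suc n)))

entry-shifted : ∀ m n {i j r s} → i < F (suc m) → r < F (suc m) → j < F (suc n) → s < F (suc n) →
  entry (shifted m n i j) r s ≡ letter (circ m (i + r)) (circ n (j + s))
entry-shifted m n {i} {j} {r} {s} i<F r<F j<F s<F = begin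
  entry (iter i Trow X) r s                    ≡⟨ entry≡lookupOr (iter i Trow X) r s ⟩
  lookupOr a (lookupOr R (iter i rot X) r) s   ≡⟨ cong (λ w → lookupOr a w s) (lookupOr-iter-rot R X i<F r<F) ⟩
  lookupOr a (lookupOr R (X ++ᵛ X) (i + r)) s  ≡⟨ cong (λ w → lookupOr a w s) rows ⟩
  lookupOr a (iter j rot (row β)) s            ≡⟨ lookupOr-iter-rot a (row β) j<F s<F ⟩
  lookupOr a (row β ++ᵛ row β) (j + s)         ≡⟨ columns ⟩
  letter β (circ n (j + s))                    ∎
  where
  X = iter j Tcol (fw (suc m) (suc n))
  R = replicate (F (suc n)) a
  row : Bool → Vec Letter (F (suc n))
  row β = fibRow β (suc n)
  β = circ m (i + r)
  X-row : ∀ {t} → t < F (suc m) → lookupOr R X t ≡ iter j rot (row (nth (fib (suc m)) t))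
  X-row t<F = trans (lookupOr-iter-Tcol (fw (suc m) (suc n)) j t<F)
                    (cong (iter j rot) (lookupOr-fw (suc m) (suc n) t<F))
  rows : lookupOr R (X ++ᵛ X) (i + r) ≡ iter j rot (row β)
  rows = lookupOr-twice R (λ γ → iter j rot (row γ)) X (fib (suc m)) (length-fib (suc m)) X-row
           (+-mono-< i<F r<F)
  columns : lookupOr a (row β ++ᵛ row β) (j + s) ≡ letter β (circ n (j + s))
  columns = lookupOr-twice a (letter β) (row β) (fib (suc n)) (length-fib (suc n)) (lookupOr-fibRow β (suc n))
              (+-mono-< j<F s<F)

-- The two-dimensional theorem

block-entries : ∀ (g : ℕ → ℕ → Letter) i j (g′ : ℕ → ℕ → Letter) i′ j′ {k l} →
  block g i j k l ≡ block g′ i′ j′ k l →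
  ∀ {r s} → r < k → s < l → g (i + r) (j + s) ≡ g′ (i′ + r) (j′ + s)
block-entries g i j g′ i′ j′ eq {r} {s} r<k s<l =
  subst₂ (λ r s → g (i + r) (j + s) ≡ g′ (i′ + r) (j′ + s)) (toℕ-fromℕ< r<k) (toℕ-fromℕ< s<l)
    (trans (sym (at-block g i j)) (trans (cong (λ w → lookup (lookup w (fromℕ< r<k)) (fromℕ< s<l)) eq)
           (at-block g′ i′ j′)))
  where
  at-block : ∀ h i j → lookup (lookup (block h i j _ _) (fromℕ< r<k)) (fromℕ< s<l)
                     ≡ h (i + toℕ (fromℕ< r<k)) (j + toℕ (fromℕ< s<l))
  at-block h i j = trans (cong (λ w → lookup w (fromℕ< s<l)) (lookup∘tabulate _ (fromℕ< r<k)))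
                         (lookup∘tabulate _ (fromℕ< s<l))

block-ext : ∀ (g : ℕ → ℕ → Letter) i j (g′ : ℕ → ℕ → Letter) i′ j′ {k l} →
  (∀ {r s} → r < k → s < l → g (i + r) (j + s) ≡ g′ (i′ + r) (j′ + s)) →
  block g i j k l ≡ block g′ i′ j′ k l
block-ext g i j g′ i′ j′ same = tabulate-cong λ r → tabulate-cong λ s → same (toℕ<n r) (toℕ<n s)

rowBit colBit : Letter → Bool
rowBit a = false
rowBit b = false
rowBit c = true
rowBit d = true
colBit a = false
colBit b = true
colBit c = false
colBit d = true

rowBit-letter : ∀ β γ → rowBit (letter β γ) ≡ β
rowBit-letter true true = refl
rowBit-letter true false = refl
rowBit-letter false true = refl
rowBit-letter false false = refl

colBit-letter : ∀ β γ → colBit (letter β γ) ≡ γ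
colBit-letter true true = refl
colBit-letter true false = refl
colBit-letter false true = refl
colBit-letter false false = refl

InIdx⇒InIdx′ : ∀ m k {i} → InIdx m k i → InIdx′ m k i
InIdx⇒InIdx′ m k (inj₁ i<F) = inj₁ i<F
InIdx⇒InIdx′ m k {i} (inj₂ (le , i<F)) =
  inj₂ (≤-trans (m≤n+m∸n X k) (+-monoʳ-≤ k (∸1≤⇒≤suc (X ∸ k) le)) , i<F)
  where
  X = F (suc (suc m))
  ∸1≤⇒≤suc : ∀ z → z ∸ 1 ≤ i → z ≤ suc i
  ∸1≤⇒≤suc zero _ = z≤n
  ∸1≤⇒≤suc (suc z) z≤i = s≤s z≤i

InIdx′⇒InIdx : ∀ m k {i} → InIdx′ m k i → InIdx m k i
InIdx′⇒InIdx m k (inj₁ i<F) = inj₁ i<F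
InIdx′⇒InIdx m k (inj₂ (le , i<F)) =
  inj₂ (∸-monoˡ-≤ 1 (m≤n+o⇒m∸n≤o (F (suc (suc m))) k le) , i<F)

InIdx-bound : ∀ m k {i} → InIdx m k i → i < F (suc m)
InIdx-bound m k (inj₁ i<F) = <-≤-trans i<F (F-step m)
InIdx-bound m k (inj₂ (_ , i<F)) = i<F

x-window-start : ∀ m {k} → F m ≤ k → k < F (suc m) →
  ∀ p → ∃[ i ] InIdx′ m k i × Agree k (λ q → x (suc q)) p (circ m) i
x-window-start zero () (s≤s z≤n)
x-window-start (suc m) = Covering.x-window-start m

shiftedPrefix-entry : ∀ m n {k l i j} → k < F (suc m) → l < F (suc n) → InIdx m k i → InIdx n l j →
  ∀ {r s} → r < k → s < l →
  entry (shifted m n i j) r s ≡ letter (circ m (i + r)) (circ n (j + s))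
shiftedPrefix-entry m n {k} {l} k<F l<F Ii Ij r<k s<l =
  entry-shifted m n (InIdx-bound m k Ii) (<-trans r<k k<F) (InIdx-bound n l Ij) (<-trans s<l l<F)

shiftedPrefix-injective : ∀ m n {k l} → F m ≤ k → k < F (suc m) → F n ≤ l → l < F (suc n) →
  (i j i′ j′ : ℕ) → InIdx m k i → InIdx n l j → InIdx m k i′ → InIdx n l j′ →
  shiftedPrefix m n k l i j ≡ shiftedPrefix m n k l i′ j′ → i ≡ i′ × j ≡ j′
shiftedPrefix-injective m n {k} {l} Fm≤k k<F Fn≤l l<F i j i′ j′ Ii Ij Ii′ Ij′ eq =
  distinct m Fm≤k k<F (InIdx⇒InIdx′ m k Ii) (InIdx⇒InIdx′ m k Ii′)
    (λ r r<k → trans (sym (rowBit-letter _ _)) (trans (cong rowBit (same r<k 0<l)) (rowBit-letter _ _))) ,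
  distinct n Fn≤l l<F (InIdx⇒InIdx′ n l Ij) (InIdx⇒InIdx′ n l Ij′)
    (λ s s<l → trans (sym (colBit-letter _ _)) (trans (cong colBit (same 0<k s<l)) (colBit-letter _ _)))
  where
  0<k : 0 < k
  0<k = <-≤-trans (F-pos m) Fm≤k
  0<l : 0 < l
  0<l = <-≤-trans (F-pos n) Fn≤l
  same : ∀ {r s} → r < k → s < l →
    letter (circ m (i + r)) (circ n (j + s)) ≡ letter (circ m (i′ + r)) (circ n (j′ + s))
  same r<k s<l = trans (sym (shiftedPrefix-entry m n k<F l<F Ii Ij r<k s<l))
    (trans (block-entries (entry (shifted m n i j)) 0 0 (entry (shifted m n i′ j′)) 0 0 eq r<k s<l)
           (shiftedPrefix-entry m n k<F l<F Ii′ Ij′ r<k s<l))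

shiftedPrefix-factor : ∀ m n {k l} → k < F (suc m) → l < F (suc n) →
  (i j : ℕ) → InIdx m k i → InIdx n l j → ∃₂ λ p q → shiftedPrefix m n k l i j ≡ factor p q k l
shiftedPrefix-factor m n {k} {l} k<F l<F i j Ii Ij =
  P , Q , block-ext (entry (shifted m n i j)) 0 0 fInf (suc P) (suc Q) λ r<k s<l →
    trans (shiftedPrefix-entry m n k<F l<F Ii Ij r<k s<l)
          (cong₂ letter (in-x m (InIdx-bound m k Ii) (<-trans r<k k<F))
                        (in-x n (InIdx-bound n l Ij) (<-trans s<l l<F)))
  where
  P = F (suc (suc m)) + i
  Q = F (suc (suc n)) + j
  in-x : ∀ m {i r} → i < F (suc m) → r < F (suc m) → circ m (i + r) ≡ x (suc (F (suc (suc m)) + i + r))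
  in-x m {i} {r} i<F r<F =
    trans (circ≡x m (+-mono-< i<F r<F)) (cong (λ t → x (suc t)) (sym (+-assoc (F (suc (suc m))) i r)))

factor-shiftedPrefix : ∀ m n {k l} → F m ≤ k → k < F (suc m) → F n ≤ l → l < F (suc n) →
  (p q : ℕ) → ∃₂ λ i j → InIdx m k i × InIdx n l j × factor p q k l ≡ shiftedPrefix m n k l i j
factor-shiftedPrefix m n {k} {l} Fm≤k k<F Fn≤l l<F p q
  with x-window-start m Fm≤k k<F p | x-window-start n Fn≤l l<F q
... | i , Ii′ , row-agree | j , Ij′ , col-agree =
  i , j , Ii , Ij , block-ext fInf (suc p) (suc q) (entry (shifted m n i j)) 0 0 λ {r} {s} r<k s<l →
    trans (cong₂ letter (row-agree r r<k) (col-agree s s<l))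
          (sym (shiftedPrefix-entry m n k<F l<F Ii Ij r<k s<l))
  where
  Ii = InIdx′⇒InIdx m k Ii′
  Ij = InIdx′⇒InIdx n l Ij′

mainTheorem6 : (m n k l : ℕ) → 2 ≤ m → 2 ≤ n →
    F m ≤ k → k < F (suc m) → F n ≤ l → l < F (suc n) →
      -- the (k+1)(l+1) prefixes are pairwise distinct
      ((i j i′ j′ : ℕ) → InIdx m k i → InIdx n l j → InIdx m k i′ → InIdx n l j′ →
        shiftedPrefix m n k l i j ≡ shiftedPrefix m n k l i′ j′ → (i ≡ i′ × j ≡ j′))
      -- each of them is a factor of f∞,∞ of size (k,l)
      × ((i j : ℕ) → InIdx m k i → InIdx n l j →
        ∃₂ λ p q → shiftedPrefix m n k l i j ≡ factor p q k l)
      -- every factor of f∞,∞ of size (k,l) is one of them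
      × ((p q : ℕ) → ∃₂ λ i j → InIdx m k i × InIdx n l j ×
        factor p q k l ≡ shiftedPrefix m n k l i j)
mainTheorem6 m n k l _ _ Fm≤k k<F Fn≤l l<F =
  shiftedPrefix-injective m n Fm≤k k<F Fn≤l l<F ,
  shiftedPrefix-factor m n k<F l<F ,
  factor-shiftedPrefix m n Fm≤k k<F Fn≤l l<F
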